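{- Let $\alpha\ge5/3$. Let $G$ be an instance of MAP that is 2-node connected. Let $e,f$ be a pair of parallel edges of $G$, where $f$ is a unit-edge. Let $B'$ be a 2-ECSS of $G-f$ of cost at most $\max(\mathrm{opt}(G-f),\ \alpha\,\mathrm{opt}(G-f)-2)$. Then $B'$ is a 2-ECSS of $G$ of cost at most $\max(\mathrm{opt}(G),\ \alpha\,\mathrm{opt}(G)-2)$.
   Context: An instance of MAP is a loop-free, 2-edge connected multigraph with edge costs in $\{0,1\}$ whose cost-$0$ edges form a matching; cost-$1$ edges are unit-edges. A graph is 2-edge connected if it has at least $2$ nodes and is connected after removing any single edge. It is 2-node connected if it has at least $3$ nodes and is connected after removing any single node. A 2-ECSS is a 2-edge connected spanning subgraph, and $\mathrm{opt}(\cdot)$ is the minimum cost of a 2-ECSS.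
   Formalization: The parameter α ranges over the rationals with α ≥ 5/3 rather than over the reals. -}

module Defs where

open import Data.Nat using (ℕ; _≤_; _+_)
open import Data.Fin using (Fin; _≟_)
open import Data.Bool using (Bool; true; false; if_then_else_)
open import Data.List using (List; map; allFin)
open import Data.Nat.ListAction using (sum)
open import Data.Product using (_×_; _,_; proj₁; proj₂)
open import Data.Sum using (_⊎_)
open import Data.Unit using (⊤)
open import Data.Integer using (+_)
open import Data.Rational using (ℚ; _/_; _*_; _-_; _⊔_)
import Data.Rational as Q
open import Relation.Nullary using (¬_)
open import Relation.Nullary.Decidable using (⌊_⌋)
open import Relation.Binary.PropositionalEquality using (_≡_; _≢_)

-- A finite loop-free multigraph with edge costs:
-- nodes are Fin n, edges are Fin m, each edge has an (unordered) pair of ends.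
record Graph : Set where
  field
    n    : ℕ
    m    : ℕ
    ends : Fin m → Fin n × Fin n
    cost : Fin m → ℕ
open Graph public

EdgeSet : ℕ → Set
EdgeSet m = Fin m → Bool

allEdges : ∀ {m} → EdgeSet m
allEdges _ = true

_∖_ : ∀ {m} → EdgeSet m → Fin m → EdgeSet m
(S ∖ f) e = if ⌊ e ≟ f ⌋ then false else S e

_⊆ₑ_ : ∀ {m} → EdgeSet m → EdgeSet m → Set
S ⊆ₑ H = ∀ e → S e ≡ true → H e ≡ true

module _ (G : Graph) where

  Joins : Fin (m G) → Fin (n G) → Fin (n G) → Set
  Joins e u w = ends G e ≡ (u , w) ⊎ ends G e ≡ (w , u)

  data Walk (X : Fin (n G) → Set) (S : EdgeSet (m G)) : Fin (n G) → Fin (n G) → Set where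
    here : ∀ {u} → X u → Walk X S u u
    step : ∀ {u w v} (e : Fin (m G)) → X u → S e ≡ true → Joins e u w →
           Walk X S w v → Walk X S u v

  -- the subgraph with node set {v | X v} and edge set S is connected
  -- (edges of S with an end outside X are effectively deleted, since walks avoid those nodes)
  Connected : (Fin (n G) → Set) → EdgeSet (m G) → Set
  Connected X S = ∀ u v → X u → X v → Walk X S u v

  AllNodes : Fin (n G) → Set
  AllNodes _ = ⊤

  TwoEdgeConnected : EdgeSet (m G) → Set
  TwoEdgeConnected S =
    2 ≤ n G × Connected AllNodes S × (∀ e → S e ≡ true → Connected AllNodes (S ∖ e))

  TwoNodeConnected : EdgeSet (m G) → Set
  TwoNodeConnected S =
    3 ≤ n G × Connected AllNodes S × (∀ v → Connected (λ w → w ≢ v) S)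

  LoopFree : Set
  LoopFree = ∀ e → proj₁ (ends G e) ≢ proj₂ (ends G e)

  ShareEnd : Fin (m G) → Fin (m G) → Set
  ShareEnd e e' = proj₁ (ends G e) ≡ proj₁ (ends G e') ⊎ proj₁ (ends G e) ≡ proj₂ (ends G e')
                ⊎ proj₂ (ends G e) ≡ proj₁ (ends G e') ⊎ proj₂ (ends G e) ≡ proj₂ (ends G e')

  IsMAP : Set
  IsMAP = LoopFree
        × TwoEdgeConnected allEdges
        × (∀ e → cost G e ≡ 0 ⊎ cost G e ≡ 1)
        × (∀ e e' → e ≢ e' → cost G e ≡ 0 → cost G e' ≡ 0 → ¬ ShareEnd e e')

  UnitEdge : Fin (m G) → Set
  UnitEdge e = cost G e ≡ 1

  Parallel : Fin (m G) → Fin (m G) → Set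
  Parallel e f = e ≢ f × Joins f (proj₁ (ends G e)) (proj₂ (ends G e))

  costOf : EdgeSet (m G) → ℕ
  costOf S = sum (map (λ e → if S e then cost G e else 0) (allFin (m G)))

  Is2ECSS : EdgeSet (m G) → EdgeSet (m G) → Set
  Is2ECSS H S = S ⊆ₑ H × TwoEdgeConnected S

  IsOpt : EdgeSet (m G) → ℕ → Set
  IsOpt H k = (Σ' H k) × (∀ S → Is2ECSS H S → k ≤ costOf S)
    where
    Σ' : EdgeSet (m G) → ℕ → Set
    Σ' H k = Data.Product.Σ (EdgeSet (m G)) (λ S → Is2ECSS H S × costOf S ≡ k)

ℕtoℚ : ℕ → ℚ
ℕtoℚ k = (+ k) / 1

WithinBound : ℚ → ℕ → ℕ → Set
WithinBound α opt c = ℕtoℚ c Q.≤ (ℕtoℚ opt ⊔ (α * ℕtoℚ opt - ℕtoℚ 2))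

module Submission where

-- Deleting a unit-edge f that has a parallel edge e does not
-- change the optimum: opt(G - f) = opt(G).  Then B', being within the bound
-- for opt(G - f), is within the same bound for opt(G); and B' is a 2-ECSS of G
-- simply because it is a 2-ECSS of the subgraph G - f.
--
-- opt(G - f) ≤ opt(G) is the substance: every 2-ECSS S of G is turned into a
-- 2-ECSS T of G - f with cost T ≤ cost S.  If f ∉ S take T = S.  Otherwise let
-- u, v be the ends of e and f and S₀ = S - f - e.  Since S - f is connected,
-- every node reaches u or v in S₀.  If S₀ has a u–v walk (e.g. when e ∉ S),
-- T = S - f + e works.  If not, 2-node connectivity of G gives a walk avoiding
-- u from a third node to v, and on it an edge g ∉ {e, f} crossing from the
-- u-side to the v-side of S₀; then T = S - f + g works.  Costs never rise,
-- since f is a most expensive edge.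

open import Defs
open import Data.Integer using (+_)
open import Data.Rational using (ℚ; _/_; _≤_)
open import Data.Fin using (Fin; zero; suc; _≟_)
open import Data.Product using (_×_; Σ; _,_; proj₁; proj₂; swap)
open import Data.Nat as ℕ using (ℕ; _+_; z≤n; s≤s)
import Data.Nat.Properties as ℕ
import Data.Fin.Properties as Fin
open import Algebra.Properties.CommutativeSemigroup ℕ.+-commutativeSemigroup
  using (xy∙z≈xz∙y)
open import Data.Bool using (true; false; if_then_else_)
open import Data.List using (tabulate)
open import Data.List.Properties using (map-tabulate)
open import Data.Nat.ListAction using (sum)
open import Data.Sum using (_⊎_; inj₁; inj₂) renaming (map to map⊎; swap to swap⊎)
open import Data.Empty using (⊥-elim)
open import Data.Unit using (tt)
open import Function using (_∘_)
open import Relation.Nullary using (yes; no)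
open import Relation.Nullary.Decidable using (⌊_⌋)
open import Relation.Binary.PropositionalEquality
  using (_≡_; _≢_; refl; sym; trans; cong)

insert : ∀ {M} → Fin M → EdgeSet M → EdgeSet M
insert g S x = if ⌊ x ≟ g ⌋ then true else S x

∖-self : ∀ {M} (S : EdgeSet M) (f : Fin M) → (S ∖ f) f ≡ false
∖-self S f with f ≟ f
... | yes _ = refl
... | no f≢f = ⊥-elim (f≢f refl)

∖-other : ∀ {M} (S : EdgeSet M) {f x : Fin M} → x ≢ f → (S ∖ f) x ≡ S x
∖-other S {f} {x} x≢f with x ≟ f
... | yes x≡f = ⊥-elim (x≢f x≡f)
... | no _ = refl

∖-keep : ∀ {M} (S : EdgeSet M) {f x : Fin M} → x ≢ f → S x ≡ true → (S ∖ f) x ≡ true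
∖-keep S x≢f Sx = trans (∖-other S x≢f) Sx

∖-member : ∀ {M} (S : EdgeSet M) {f x : Fin M} → (S ∖ f) x ≡ true → S x ≡ true × x ≢ f
∖-member S {f} {x} p with x ≟ f
... | no x≢f = p , x≢f

insert-self : ∀ {M} (g : Fin M) (S : EdgeSet M) → insert g S g ≡ true
insert-self g S with g ≟ g
... | yes _ = refl
... | no g≢g = ⊥-elim (g≢g refl)

insert-other : ∀ {M} {g x : Fin M} (S : EdgeSet M) → x ≢ g → insert g S x ≡ S x
insert-other {g = g} {x} S x≢g with x ≟ g
... | yes x≡g = ⊥-elim (x≢g x≡g)
... | no _ = refl

insert-keep : ∀ {M} {g x : Fin M} (S : EdgeSet M) → S x ≡ true → insert g S x ≡ true
insert-keep {g = g} {x} S Sx with x ≟ g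
... | yes _ = refl
... | no _ = Sx

member-≢ : ∀ {M} {S : EdgeSet M} {x h : Fin M} → S x ≡ true → S h ≡ false → x ≢ h
member-≢ Sx Sh refl with trans (sym Sh) Sx
... | ()

⊆-minus : ∀ {M} {S : EdgeSet M} {f : Fin M} → S f ≡ false → S ⊆ₑ (allEdges ∖ f)
⊆-minus Sf x Sx = ∖-keep allEdges (member-≢ Sx Sf) refl

sum-mono : ∀ {M} (a b : Fin M → ℕ) → (∀ x → a x ℕ.≤ b x) →
           sum (tabulate a) ℕ.≤ sum (tabulate b)
sum-mono {ℕ.zero} a b a≤b = z≤n
sum-mono {ℕ.suc M} a b a≤b = ℕ.+-mono-≤ (a≤b zero) (sum-mono (a ∘ suc) (b ∘ suc) (a≤b ∘ suc))

sum-exchange : ∀ {M} (a b : Fin M → ℕ) (f : Fin M) {c d : ℕ} →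
  (∀ x → x ≢ f → a x ℕ.≤ b x) → a f + c ℕ.≤ b f + d →
  sum (tabulate a) + c ℕ.≤ sum (tabulate b) + d
sum-exchange a b zero {c} {d} a≤b at-f = begin
  a zero + sum (tabulate (a ∘ suc)) + c  ≡⟨ xy∙z≈xz∙y (a zero) _ c ⟩
  a zero + c + sum (tabulate (a ∘ suc))  ≤⟨ ℕ.+-mono-≤ at-f rest ⟩
  b zero + d + sum (tabulate (b ∘ suc))  ≡⟨ xy∙z≈xz∙y (b zero) _ d ⟨
  b zero + sum (tabulate (b ∘ suc)) + d  ∎
  where
  open ℕ.≤-Reasoning
  rest : sum (tabulate (a ∘ suc)) ℕ.≤ sum (tabulate (b ∘ suc))
  rest = sum-mono (a ∘ suc) (b ∘ suc) (λ x → a≤b (suc x) (λ ()))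
sum-exchange a b (suc f) {c} {d} a≤b at-f = begin
  a zero + sum (tabulate (a ∘ suc)) + c    ≡⟨ ℕ.+-assoc (a zero) _ c ⟩
  a zero + (sum (tabulate (a ∘ suc)) + c)  ≤⟨ ℕ.+-mono-≤ (a≤b zero (λ ())) rest ⟩
  b zero + (sum (tabulate (b ∘ suc)) + d)  ≡⟨ ℕ.+-assoc (b zero) _ d ⟨
  b zero + sum (tabulate (b ∘ suc)) + d    ∎
  where
  open ℕ.≤-Reasoning
  rest : sum (tabulate (a ∘ suc)) + c ℕ.≤ sum (tabulate (b ∘ suc)) + d
  rest = sum-exchange (a ∘ suc) (b ∘ suc) f (λ x x≢f → a≤b (suc x) (x≢f ∘ Fin.suc-injective)) at-f

module Costs (G : Graph) where

  weight : EdgeSet (m G) → Fin (m G) → ℕ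
  weight S x = if S x then cost G x else 0

  costOf-tabulate : ∀ S → costOf G S ≡ sum (tabulate (weight S))
  costOf-tabulate S = cong sum (map-tabulate (λ x → x) (weight S))

  cost-compare : ∀ (S S' : EdgeSet (m G)) (h : Fin (m G)) {c d} →
    (∀ x → x ≢ h → S x ≡ S' x) → weight S h + c ℕ.≤ weight S' h + d →
    costOf G S + c ℕ.≤ costOf G S' + d
  cost-compare S S' h {c} {d} agree at-h
    rewrite costOf-tabulate S | costOf-tabulate S' =
    sum-exchange (weight S) (weight S') h
      (λ x x≢h → ℕ.≤-reflexive (cong (λ b → if b then cost G x else 0) (agree x x≢h))) at-h

  cost-delete : ∀ S f → S f ≡ true → costOf G (S ∖ f) + cost G f ℕ.≤ costOf G S + 0
  cost-delete S f Sf = cost-compare (S ∖ f) S f (λ x → ∖-other S) at-f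
    where
    at-f : weight (S ∖ f) f + cost G f ℕ.≤ weight S f + 0
    at-f rewrite ∖-self S f | Sf = ℕ.≤-reflexive (ℕ.+-comm 0 (cost G f))

  cost-insert : ∀ S g → costOf G (insert g S) + 0 ℕ.≤ costOf G S + cost G g
  cost-insert S g = cost-compare (insert g S) S g (λ x → insert-other S) at-g
    where
    at-g : weight (insert g S) g + 0 ℕ.≤ weight S g + cost G g
    at-g rewrite insert-self g S = ℕ.≤-trans (ℕ.≤-reflexive (ℕ.+-identityʳ (cost G g)))
                                             (ℕ.m≤n+m (cost G g) (weight S g))

  exchange-cost : ∀ S f g → S f ≡ true → cost G g ℕ.≤ cost G f →
                  costOf G (insert g (S ∖ f)) ℕ.≤ costOf G S
  exchange-cost S f g Sf g≤f = begin
    costOf G (insert g (S ∖ f))       ≡⟨ ℕ.+-identityʳ _ ⟨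
    costOf G (insert g (S ∖ f)) + 0   ≤⟨ cost-insert (S ∖ f) g ⟩
    costOf G (S ∖ f) + cost G g       ≤⟨ ℕ.+-monoʳ-≤ (costOf G (S ∖ f)) g≤f ⟩
    costOf G (S ∖ f) + cost G f       ≤⟨ cost-delete S f Sf ⟩
    costOf G S + 0                    ≡⟨ ℕ.+-identityʳ _ ⟩
    costOf G S                        ∎
    where open ℕ.≤-Reasoning

module Walks (G : Graph) where

  Node Edge : Set
  Node = Fin (n G)
  Edge = Fin (m G)

  W : EdgeSet (m G) → Node → Node → Set
  W = Walk G (AllNodes G)

  walk-start : ∀ {X S a b} → Walk G X S a b → X a
  walk-start (here x) = x
  walk-start (step _ x _ _ _) = x

  _++_ : ∀ {X S a b c} → Walk G X S a b → Walk G X S b c → Walk G X S a c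
  here _ ++ q = q
  step g x s j p ++ q = step g x s j (p ++ q)

  joins-sym : ∀ {g : Edge} {a b} → Joins G g a b → Joins G g b a
  joins-sym (inj₁ p) = inj₂ p
  joins-sym (inj₂ p) = inj₁ p

  reverse : ∀ {X S a b} → Walk G X S a b → Walk G X S b a
  reverse (here x) = here x
  reverse (step g x s j p) = reverse p ++ step g (walk-start p) s (joins-sym j) (here x)

  end-of-joins : ∀ {g : Edge} {a b y z} → Joins G g a b → Joins G g y z → y ≡ a ⊎ y ≡ b
  end-of-joins (inj₁ A) (inj₁ Y) = inj₁ (cong proj₁ (trans (sym Y) A))
  end-of-joins (inj₁ A) (inj₂ Y) = inj₂ (cong proj₂ (trans (sym Y) A))
  end-of-joins (inj₂ A) (inj₁ Y) = inj₂ (cong proj₁ (trans (sym Y) A))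
  end-of-joins (inj₂ A) (inj₂ Y) = inj₁ (cong proj₂ (trans (sym Y) A))

  avoids-end : ∀ {g h : Edge} {a b p q} → Joins G h a b → Joins G g p q → p ≢ a → q ≢ a → g ≢ h
  avoids-end Jh Jg p≢a q≢a refl with end-of-joins Jg Jh
  ... | inj₁ a≡p = p≢a (sym a≡p)
  ... | inj₂ a≡q = q≢a (sym a≡q)

  ordered-transfer : ∀ {g h : Edge} {a b p q} → Joins G g a b → Joins G h a b →
                     ends G g ≡ (p , q) → Joins G h p q
  ordered-transfer (inj₁ Ga) (inj₁ Ha) P = inj₁ (trans Ha (trans (sym Ga) P))
  ordered-transfer (inj₁ Ga) (inj₂ Hb) P = inj₂ (trans Hb (cong swap (trans (sym Ga) P)))
  ordered-transfer (inj₂ Gb) (inj₁ Ha) P = inj₂ (trans Ha (cong swap (trans (sym Gb) P)))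
  ordered-transfer (inj₂ Gb) (inj₂ Hb) P = inj₁ (trans Hb (trans (sym Gb) P))

  joins-transfer : ∀ {g h : Edge} {a b p q} → Joins G g a b → Joins G h a b →
                   Joins G g p q → Joins G h p q
  joins-transfer Ga Ha (inj₁ P) = ordered-transfer Ga Ha P
  joins-transfer Ga Ha (inj₂ P) = joins-sym (ordered-transfer Ga Ha P)

  walk-mono : ∀ {X} {A B : EdgeSet (m G)} {a b} → A ⊆ₑ B → Walk G X A a b → Walk G X B a b
  walk-mono A⊆B (here x) = here x
  walk-mono A⊆B (step g x s j p) = step g x (A⊆B g s) j (walk-mono A⊆B p)

  walk-reroute : ∀ {X} {A B : EdgeSet (m G)} {a b} {e f : Edge} →
    (∀ {p q} → Joins G f p q → Joins G e p q) → B e ≡ true →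
    (∀ x → A x ≡ true → x ≢ f → B x ≡ true) →
    Walk G X A a b → Walk G X B a b
  walk-reroute f⇒e Be A⊆B (here x) = here x
  walk-reroute {f = f} f⇒e Be A⊆B (step g x Ag j p) with g ≟ f
  ... | yes refl = step _ x Be (f⇒e j) (walk-reroute f⇒e Be A⊆B p)
  ... | no g≢f = step g x (A⊆B g Ag g≢f) j (walk-reroute f⇒e Be A⊆B p)

  connected-via : ∀ {B : EdgeSet (m G)} {u v} → (∀ y → W B y u ⊎ W B y v) →
                  W B u v → Connected G (AllNodes G) B
  connected-via {B} {u} reach u~v a b _ _ = to-u a ++ reverse (to-u b)
    where
    to-u : ∀ y → W B y u
    to-u y with reach y
    ... | inj₁ y~u = y~u
    ... | inj₂ y~v = y~v ++ reverse u~v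

  -- A walk to u, with the edge e = uv deleted, still reaches u or v:
  -- cut it at its first use of e.
  split-at-edge : ∀ (A : EdgeSet (m G)) {e : Edge} {u v y} → Joins G e u v →
                  W A y u → W (A ∖ e) y u ⊎ W (A ∖ e) y v
  split-at-edge A Je (here x) = inj₁ (here x)
  split-at-edge A {e} Je (step g x Ag j p) with g ≟ e
  ... | yes refl with end-of-joins Je j
  ...   | inj₁ refl = inj₁ (here x)
  ...   | inj₂ refl = inj₂ (here x)
  split-at-edge A Je (step g x Ag j p) | no g≢e with split-at-edge A Je p
  ...   | inj₁ q = inj₁ (step g x (∖-keep A g≢e Ag) j q)
  ...   | inj₂ q = inj₂ (step g x (∖-keep A g≢e Ag) j q)

  record Crossing (B : EdgeSet (m G)) (a b : Node) : Set where
    constructor crossing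
    field
      edge       : Edge
      tail head  : Node
      joins      : Joins G edge tail head
      tail≢a     : tail ≢ a
      head≢a     : head ≢ a
      tail-side  : W B tail a
      head-side  : W B head b

  find-crossing : ∀ (B : EdgeSet (m G)) {a b x} → (∀ y → W B y a ⊎ W B y b) →
    Walk G (λ w → w ≢ a) allEdges x b → W B x a → W B b a ⊎ Crossing B a b
  find-crossing B reach (here _) x~a = inj₁ x~a
  find-crossing B reach (step {w = w} g x≢a _ j p) x~a with reach w
  ... | inj₁ w~a = find-crossing B reach p w~a
  ... | inj₂ w~b = inj₂ (crossing g _ w j x≢a (walk-start p) x~a w~b)

another-node : ∀ {K} → 3 ℕ.≤ K → (u v : Fin K) → Σ (Fin K) λ w → w ≢ u × w ≢ v
another-node (s≤s (s≤s (s≤s _))) zero zero = suc zero , (λ ()) , (λ ())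
another-node (s≤s (s≤s (s≤s _))) zero (suc zero) = suc (suc zero) , (λ ()) , (λ ())
another-node (s≤s (s≤s (s≤s _))) zero (suc (suc _)) = suc zero , (λ ()) , (λ ())
another-node (s≤s (s≤s (s≤s _))) (suc zero) zero = suc (suc zero) , (λ ()) , (λ ())
another-node (s≤s (s≤s (s≤s _))) (suc (suc _)) zero = suc zero , (λ ()) , (λ ())
another-node (s≤s (s≤s (s≤s _))) (suc _) (suc _) = zero , (λ ()) , (λ ())

module Exchange (G : Graph) (loopFree : LoopFree G) (twoNode : TwoNodeConnected G allEdges)
  (e f : Fin (m G)) (parallel : Parallel G e f) (f-max : ∀ g → cost G g ℕ.≤ cost G f)
  (S : EdgeSet (m G)) (S-2ec : TwoEdgeConnected G S) where
  open Walks G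
  open Costs G using (exchange-cost)

  u v : Node
  u = proj₁ (ends G e)
  v = proj₂ (ends G e)

  e-joins : Joins G e u v
  e-joins = inj₁ refl

  f-joins : Joins G f u v
  f-joins = proj₂ parallel

  f⇒e : ∀ {p q} → Joins G f p q → Joins G e p q
  f⇒e = joins-transfer f-joins e-joins

  u≢v : u ≢ v
  u≢v = loopFree e

  e≢f : e ≢ f
  e≢f = proj₁ parallel

  connected-S : Connected G (AllNodes G) S
  connected-S = proj₁ (proj₂ S-2ec)

  cut-S : ∀ h → S h ≡ true → Connected G (AllNodes G) (S ∖ h)
  cut-S = proj₂ (proj₂ S-2ec)

  avoiding : ∀ a → Connected G (λ x → x ≢ a) allEdges
  avoiding = proj₂ (proj₂ twoNode)

  Improvement : Set
  Improvement = Σ (EdgeSet (m G)) λ T → Is2ECSS G (allEdges ∖ f) T × costOf G T ℕ.≤ costOf G S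

  S₀ : EdgeSet (m G)
  S₀ = (S ∖ f) ∖ e

  S₀-member : ∀ {x} → S₀ x ≡ true → S x ≡ true × x ≢ f × x ≢ e
  S₀-member p with ∖-member (S ∖ f) p
  ... | q , x≢e with ∖-member S q
  ...   | Sx , x≢f = Sx , x≢f , x≢e

  -- Since S - f is connected, every node reaches u or v in S₀.
  reach : S f ≡ true → ∀ y → W S₀ y u ⊎ W S₀ y v
  reach Sf y = split-at-edge (S ∖ f) e-joins (cut-S f Sf y u tt tt)

  connected-over-S₀ : S f ≡ true → ∀ {B} → S₀ ⊆ₑ B → W B u v → Connected G (AllNodes G) B
  connected-over-S₀ Sf S₀⊆B = connected-via (λ y → map⊎ (walk-mono S₀⊆B) (walk-mono S₀⊆B) (reach Sf y))

  -- T = S - f + g is a no more expensive 2-ECSS of G - f as soon as e ∈ T and deleting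
  -- e or g leaves T connected: any other cut S - h carries over to T - h by
  -- rerouting f through e.
  module Swap (g : Edge) (g≢f : g ≢ f) (Sf : S f ≡ true) where
    T : EdgeSet (m G)
    T = insert g (S ∖ f)

    T-keeps : ∀ x → S x ≡ true → x ≢ f → T x ≡ true
    T-keeps x Sx x≢f = insert-keep (S ∖ f) (∖-keep S x≢f Sx)

    S₀⊆T∖ : ∀ h → (∀ x → S₀ x ≡ true → x ≢ h) → S₀ ⊆ₑ (T ∖ h)
    S₀⊆T∖ h avoids x p with S₀-member p
    ... | Sx , x≢f , _ = ∖-keep T (avoids x p) (T-keeps x Sx x≢f)

    improvement : T e ≡ true → Connected G (AllNodes G) (T ∖ e) →
                  (g ≢ e → Connected G (AllNodes G) (T ∖ g)) → Improvement
    improvement Te cut-e cut-g =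
      T , (T-avoids-f , proj₁ S-2ec , connected-T , cut-T) , exchange-cost S f g Sf (f-max g)
      where
      T-avoids-f : T ⊆ₑ (allEdges ∖ f)
      T-avoids-f = ⊆-minus (trans (insert-other (S ∖ f) (g≢f ∘ sym)) (∖-self S f))

      connected-T : Connected G (AllNodes G) T
      connected-T a b _ _ = walk-reroute f⇒e Te T-keeps (connected-S a b tt tt)

      cut-T : ∀ h → T h ≡ true → Connected G (AllNodes G) (T ∖ h)
      cut-T h Th with h ≟ e | h ≟ g
      ... | yes refl | _ = cut-e
      ... | no h≢e | yes refl = cut-g h≢e
      ... | no h≢e | no _ = λ a b _ _ →
        walk-reroute f⇒e (∖-keep T (h≢e ∘ sym) Te) keeps (cut-S h Sh a b tt tt)
        where
        -- as h ≢ g, the membership Th has reduced to h ∈ S - f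
        Sh : S h ≡ true
        Sh = proj₁ (∖-member S Th)

        keeps : ∀ x → (S ∖ h) x ≡ true → x ≢ f → (T ∖ h) x ≡ true
        keeps x p x≢f with ∖-member S p
        ... | Sx , x≢h = ∖-keep T x≢h (T-keeps x Sx x≢f)

  via-e : S f ≡ true → W S₀ u v → Improvement
  via-e Sf u~v = improvement (insert-self e (S ∖ f)) cut-e (λ e≢e → ⊥-elim (e≢e refl))
    where
    open Swap e e≢f Sf
    S₀⊆T∖e : S₀ ⊆ₑ (T ∖ e)
    S₀⊆T∖e = S₀⊆T∖ e (λ x p → proj₂ (proj₂ (S₀-member p)))

    cut-e : Connected G (AllNodes G) (T ∖ e)
    cut-e = connected-over-S₀ Sf S₀⊆T∖e (walk-mono S₀⊆T∖e u~v)

  record Bridge : Set where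
    constructor bridge
    field
      edge      : Edge
      tail head : Node
      joins     : Joins G edge tail head
      edge≢f    : edge ≢ f
      edge≢e    : edge ≢ e
      u-side    : W S₀ u tail
      v-side    : W S₀ head v

  via-bridge : S f ≡ true → S e ≡ true → (b : Bridge) → S (Bridge.edge b) ≡ false → Improvement
  via-bridge Sf Se (bridge g p q J g≢f g≢e u~p q~v) Sg = improvement Te cut-e (λ _ → cut-g)
    where
    open Swap g g≢f Sf
    Te : T e ≡ true
    Te = T-keeps e Se e≢f

    S₀⊆T∖e : S₀ ⊆ₑ (T ∖ e)
    S₀⊆T∖e = S₀⊆T∖ e (λ x p → proj₂ (proj₂ (S₀-member p)))

    S₀⊆T∖g : S₀ ⊆ₑ (T ∖ g)
    S₀⊆T∖g = S₀⊆T∖ g (λ x p → member-≢ {S = S} (proj₁ (S₀-member {x} p)) Sg)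

    cut-e : Connected G (AllNodes G) (T ∖ e)
    cut-e = connected-over-S₀ Sf S₀⊆T∖e
      (walk-mono S₀⊆T∖e u~p ++ step g _ (∖-keep T g≢e (insert-self g (S ∖ f))) J (walk-mono S₀⊆T∖e q~v))

    cut-g : Connected G (AllNodes G) (T ∖ g)
    cut-g = connected-over-S₀ Sf S₀⊆T∖g (step e _ (∖-keep T (g≢e ∘ sym) Te) e-joins (here _))

  -- Using a third node w and 2-node connectivity: w reaches (say) u in S₀, and
  -- a walk from w to v in G - u must cross from the u-side to the v-side of
  -- S₀; its crossing edge has no end at u, so it is neither e nor f.
  walk-or-bridge : S f ≡ true → W S₀ u v ⊎ Bridge
  walk-or-bridge Sf with another-node (proj₁ twoNode) u v
  ... | w , w≢u , w≢v with reach Sf w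
  ... | inj₁ w~u with find-crossing S₀ (reach Sf) (avoiding u w v w≢u (u≢v ∘ sym)) w~u
  ...   | inj₁ v~u = inj₁ (reverse v~u)
  ...   | inj₂ (crossing g p q J p≢u q≢u p~u q~v) =
          inj₂ (bridge g p q J (avoids-end f-joins J p≢u q≢u) (avoids-end e-joins J p≢u q≢u)
                       (reverse p~u) q~v)
  walk-or-bridge Sf | w , w≢u , w≢v | inj₂ w~v
    with find-crossing S₀ (swap⊎ ∘ reach Sf) (avoiding v w u w≢v u≢v) w~v
  ...   | inj₁ u~v = inj₁ u~v
  ...   | inj₂ (crossing g p q J p≢v q≢v p~v q~u) =
          inj₂ (bridge g q p (joins-sym J) (avoids-end (joins-sym f-joins) J p≢v q≢v)
                       (avoids-end (joins-sym e-joins) J p≢v q≢v) (reverse q~u) p~v)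

  improve : Improvement
  improve with S f in Sf
  ... | false = S , (⊆-minus Sf , S-2ec) , ℕ.≤-refl
  ... | true with S e in Se
  ...   | false = via-e Sf (walk-mono S∖f⊆S₀ (cut-S f Sf u v tt tt))
    where
    S∖f⊆S₀ : (S ∖ f) ⊆ₑ S₀
    S∖f⊆S₀ x p = ∖-keep (S ∖ f) (member-≢ {S = S} (proj₁ (∖-member S p)) Se) p
  ...   | true with walk-or-bridge Sf
  ...     | inj₁ u~v = via-e Sf u~v
  ...     | inj₂ b@(bridge g p q J g≢f g≢e u~p q~v) with S g in Sg
  ...       | false = via-bridge Sf Se b Sg
  ...       | true = via-e Sf (u~p ++ step g _ S₀g J q~v)
    where
    S₀g : S₀ g ≡ true
    S₀g = ∖-keep (S ∖ f) g≢e (∖-keep S g≢f Sg)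

opt-transfer : (G : Graph) (H H' : EdgeSet (m G)) → H' ⊆ₑ H →
  (∀ S → Is2ECSS G H S → Σ (EdgeSet (m G)) λ T → Is2ECSS G H' T × costOf G T ℕ.≤ costOf G S) →
  ∀ k → IsOpt G H k → IsOpt G H' k
opt-transfer G H H' H'⊆H trade k ((S , S-ecss , cost-S) , optimal) =
  (T , T-ecss , cost-T) , λ S' (S'⊆H' , S'-2ec) → optimal S' (widen S'⊆H' , S'-2ec)
  where
  widen : ∀ {S'} → S' ⊆ₑ H' → S' ⊆ₑ H
  widen S'⊆H' x p = H'⊆H x (S'⊆H' x p)

  T : EdgeSet (m G)
  T = proj₁ (trade S S-ecss)

  T-ecss : Is2ECSS G H' T
  T-ecss = proj₁ (proj₂ (trade S S-ecss))

  cost-T : costOf G T ≡ k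
  cost-T = ℕ.≤-antisym (ℕ.≤-trans (proj₂ (proj₂ (trade S S-ecss))) (ℕ.≤-reflexive cost-S))
                       (optimal T (widen (proj₁ T-ecss) , proj₂ T-ecss))

unit-is-max : ∀ (G : Graph) → (∀ g → cost G g ≡ 0 ⊎ cost G g ≡ 1) →
              ∀ {f} → UnitEdge G f → ∀ g → cost G g ℕ.≤ cost G f
unit-is-max G zero-or-one f-unit g with zero-or-one g
... | inj₁ g-free rewrite g-free = z≤n
... | inj₂ g-unit rewrite g-unit | f-unit = ℕ.≤-refl

lemma15 : (α : ℚ) → (+ 5) / 3 ≤ α →
    (G : Graph) → IsMAP G → TwoNodeConnected G allEdges →
    (e f : Fin (m G)) → Parallel G e f → UnitEdge G f →
    (B' : EdgeSet (m G)) → Is2ECSS G (allEdges ∖ f) B' →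
    (∀ k → IsOpt G (allEdges ∖ f) k → WithinBound α k (costOf G B')) →
    Is2ECSS G allEdges B' × (∀ k → IsOpt G allEdges k → WithinBound α k (costOf G B'))
lemma15 α _ G (loopFree , _ , zero-or-one , _) twoNode e f parallel f-unit B' (_ , B'-2ec) bound =
  (everything , B'-2ec) , λ k opt-G → bound k (opt-transfer G allEdges (allEdges ∖ f) everything trade k opt-G)
  where
  everything : ∀ {S : EdgeSet (m G)} → S ⊆ₑ allEdges
  everything _ _ = refl

  trade : ∀ S → Is2ECSS G allEdges S →
          Σ (EdgeSet (m G)) λ T → Is2ECSS G (allEdges ∖ f) T × costOf G T ℕ.≤ costOf G S
  trade S (_ , S-2ec) =
    Exchange.improve G loopFree twoNode e f parallel (unit-is-max G zero-or-one f-unit) S S-2ec
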